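{- Let $H$ be a vertex-transitive graph with at least two edges, and let $H'$ be obtained from $H$ by adding one new vertex of degree one, adjacent to one of the original vertices of $H$. Let $p\geq 2$ be an integer. Then there exists $n(p,H)$ such that $t_p(n,H')=t_p(n,H)$ for all $n>n(p,H)$.
   Context: All graphs are finite, simple, undirected. For a graph $G$ with degree sequence $d_1,\ldots,d_n$, $e_p(G)=\sum_{i=1}^n d_i^p$. For a fixed graph $H$, $t_p(n,H)$ is the maximum of $e_p(G)$ over all $n$-vertex graphs $G$ not containing $H$ as a subgraph. -}

module Defs where

open import Data.Nat using (ℕ; zero; suc; _+_; _^_; _≤_; _<_; _<?_)
open import Data.Bool using (Bool; true; false; if_then_else_)
open import Data.Fin using (Fin; zero; suc; toℕ; _≟_)
open import Data.List using (List; map; allFin)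
open import Data.Nat.ListAction using (sum)
open import Data.Product using (Σ; ∃; _×_; _,_)
open import Function.Definitions using (Injective; Bijective)
open import Relation.Binary.PropositionalEquality using (_≡_; refl)
open import Relation.Nullary using (¬_; does)

record Graph (n : ℕ) : Set where
  field
    adj   : Fin n → Fin n → Bool
    sym   : ∀ i j → adj i j ≡ adj j i
    irrefl : ∀ i → adj i i ≡ false
open Graph public

b2n : Bool → ℕ
b2n true = 1
b2n false = 0

degree : ∀ {n} → Graph n → Fin n → ℕ
degree {n} G i = sum (map (λ j → b2n (adj G i j)) (allFin n))

e : ℕ → ∀ {n} → Graph n → ℕ
e p {n} G = sum (map (λ i → degree G i ^ p) (allFin n))

edgeCount : ∀ {n} → Graph n → ℕ
edgeCount {n} G =
  sum (map (λ i → sum (map (λ j → if does (toℕ i <? toℕ j)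
                                  then b2n (adj G i j) else 0)
                          (allFin n)))
           (allFin n))

Contains : ∀ {n k} → Graph n → Graph k → Set
Contains {n} {k} G H =
  Σ (Fin k → Fin n) λ f → Injective _≡_ _≡_ f ×
    (∀ i j → adj H i j ≡ true → adj G (f i) (f j) ≡ true)

IsAut : ∀ {k} → Graph k → (Fin k → Fin k) → Set
IsAut H σ = Bijective _≡_ _≡_ σ × (∀ i j → adj H (σ i) (σ j) ≡ adj H i j)

VertexTransitive : ∀ {k} → Graph k → Set
VertexTransitive {k} H =
  ∀ (u v : Fin k) → Σ (Fin k → Fin k) λ σ → IsAut H σ × σ u ≡ v

IsTp : ℕ → (n : ℕ) → ∀ {k} → Graph k → ℕ → Set
IsTp p n H t =
  (Σ (Graph n) λ G → ¬ Contains G H × e p G ≡ t) ×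
  (∀ (G : Graph n) → ¬ Contains G H → e p G ≤ t)

-- H' : add a new vertex (zero) of degree one adjacent to original vertex v
-- (original vertex i of H becomes suc i).
private
  pend : ∀ {k} → Graph k → Fin k → Fin (suc k) → Fin (suc k) → Bool
  pend H v zero zero = false
  pend H v zero (suc j) = does (j ≟ v)
  pend H v (suc i) zero = does (i ≟ v)
  pend H v (suc i) (suc j) = adj H i j

  pend-sym : ∀ {k} (H : Graph k) v i j → pend H v i j ≡ pend H v j i
  pend-sym H v zero zero = refl
  pend-sym H v zero (suc j) = refl
  pend-sym H v (suc i) zero = refl
  pend-sym H v (suc i) (suc j) = sym H i j

  pend-irr : ∀ {k} (H : Graph k) v i → pend H v i i ≡ false
  pend-irr H v zero = refl
  pend-irr H v (suc i) = irrefl H i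

addPendant : ∀ {k} → Graph k → Fin k → Graph (suc k)
addPendant H v = record { adj = pend H v ; sym = pend-sym H v ; irrefl = pend-irr H v }

module Submission where

-- Let G be H′-free. A copy f of H in G has no outside neighbours: an edge from f i to some z outside
-- would carry the pendant of H′, after an automorphism of H moves its root onto i. So vertices on
-- copies of H have degree at most k. If the vertices of H have two neighbours and G has a vertex x of
-- degree D ≥ k ^ p, then x is on no copy; deleting the edges inside the copies and joining all their
-- vertices to x kills every copy of H, and e_p does not drop since x gains at least D per such vertex.
-- If H is a matching and G contains H, moving an edge of the copy shows that every vertex off the copy
-- has degree at most 1. In the remaining cases the degrees of G are at most k ^ p, so e_p(G) is at most
-- e_p of the H-free star once n > (k ^ p) ^ p. Hence every H′-free graph is dominated by an H-free one.

open import Defs hiding (sym)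
open import Data.Nat.Properties
  using (+-*-semiring; ≤-refl; ≤-trans; ≤-reflexive; <⇒≤; <⇒≱; ≰⇒>; ≤∧≢⇒<; ≤-pred; n≤0⇒n≡0; <ᵇ⇒<; <-asym;
         +-comm; +-identityʳ; *-identityʳ; *-identityˡ; *-zeroʳ; ^-zeroˡ; *-distribʳ-+;
         +-mono-≤; +-monoʳ-≤; *-monoʳ-≤; ^-monoˡ-≤; m≤m+n; m≤n+m; m<m*n; m^n>0;
         +-cancelʳ-≤; module ≤-Reasoning)
  renaming (_≟_ to _≟ℕ_)
open import Algebra.Properties.Semiring.Sum +-*-semiring
  using (sum-syntax; sum-cong-≗; ∑-distrib-+; ∑-comm; *-distribʳ-sum; sum-replicate-zero)
  renaming (sum to ∑)
open import Data.Bool using (Bool; true; false; if_then_else_; T)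
import Data.Bool.Properties as Bool
open import Data.Empty using (⊥; ⊥-elim)
open import Data.Fin using (Fin; zero; suc; toℕ; _≟_)
open import Data.Fin.Properties using (any?; all?; suc-injective; toℕ<n)
open import Data.List using (map; allFin; tabulate)
open import Data.List.Properties using (map-tabulate)
open import Data.Nat using (ℕ; zero; suc; _+_; _*_; _^_; _≤_; _<_; z≤n; s≤s; _<ᵇ_; _<?_; _≤?_)
open import Data.Nat.ListAction using (sum)
open import Data.Product using (Σ; ∃; _×_; _,_; proj₁; proj₂)
open import Data.Sum using (_⊎_; inj₁; inj₂; [_,_]′)
open import Data.Unit using (tt)
open import Data.Vec.Functional using (_∷_)
open import Function using (_∘_; id)
open import Function.Definitions using (Injective)
open import Relation.Binary.PropositionalEquality
  using (_≡_; _≢_; refl; sym; trans; cong; cong₂; subst; subst₂; module ≡-Reasoning)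
open import Relation.Nullary using (¬_; Dec; yes; no; does)
open import Relation.Nullary.Decidable using (map′; _×-dec_; _→-dec_; ¬?; dec-true; dec-false)

∑-allFin : ∀ n (f : Fin n → ℕ) → sum (map f (allFin n)) ≡ ∑[ i < n ] f i
∑-allFin n f = trans (cong sum (map-tabulate id f)) (sum-tabulate n f)
  where
  sum-tabulate : ∀ n (f : Fin n → ℕ) → sum (tabulate f) ≡ ∑ f
  sum-tabulate zero    f = refl
  sum-tabulate (suc n) f = cong (f zero +_) (sum-tabulate n (f ∘ suc))

∑-mono-≤ : ∀ {n} {f g : Fin n → ℕ} → (∀ i → f i ≤ g i) → ∑ f ≤ ∑ g
∑-mono-≤ {zero}  f≤g = z≤n
∑-mono-≤ {suc n} f≤g = +-mono-≤ (f≤g zero) (∑-mono-≤ (f≤g ∘ suc))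

∑-const : ∀ n c → ∑[ i < n ] c ≡ n * c
∑-const zero    c = refl
∑-const (suc n) c = cong (c +_) (∑-const n c)

∑-≤-const : ∀ {n} {f : Fin n → ℕ} c → (∀ i → f i ≤ c) → ∑ f ≤ n * c
∑-≤-const {n} c f≤c = ≤-trans (∑-mono-≤ f≤c) (≤-reflexive (∑-const n c))

≤-∑ : ∀ {n} (f : Fin n → ℕ) i → f i ≤ ∑ f
≤-∑ f zero    = m≤m+n (f zero) _
≤-∑ f (suc i) = ≤-trans (≤-∑ (f ∘ suc) i) (m≤n+m _ (f zero))

indicator : ∀ {n} → Fin n → Fin n → ℕ
indicator x i = b2n (does (i ≟ x))

indicator-self : ∀ {n} (x : Fin n) → indicator x x ≡ 1
indicator-self x = cong b2n (dec-true (x ≟ x) refl)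

∑-indicator : ∀ {n} (x : Fin n) → ∑ (indicator x) ≡ 1
∑-indicator {suc n} zero    = cong suc (sum-replicate-zero n)
∑-indicator {suc n} (suc x) = ∑-indicator x

∑-indicator-* : ∀ {n} (x : Fin n) c → ∑[ i < n ] (indicator x i * c) ≡ c
∑-indicator-* x c = begin
  ∑[ i < _ ] (indicator x i * c)  ≡⟨ *-distribʳ-sum c (indicator x) ⟨
  ∑ (indicator x) * c             ≡⟨ cong (_* c) (∑-indicator x) ⟩
  1 * c                           ≡⟨ +-identityʳ c ⟩
  c                               ∎
  where open ≡-Reasoning

∑-≤-indicator-* : ∀ {n} {f : Fin n → ℕ} x c → (∀ i → f i ≤ indicator x i * c) → ∑ f ≤ c
∑-≤-indicator-* x c f≤ = ≤-trans (∑-mono-≤ f≤) (≤-reflexive (∑-indicator-* x c))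

m≤m^n : ∀ m {n} → 1 ≤ n → m ≤ m ^ n
m≤m^n zero        (s≤s z≤n) = z≤n
m≤m^n m@(suc _) {suc n} _ = begin
  m          ≡⟨ *-identityʳ m ⟨
  m * 1      ≤⟨ *-monoʳ-≤ m (m^n>0 m n) ⟩
  m * m ^ n  ∎
  where open ≤-Reasoning

m*m≤m^n : ∀ m {n} → 2 ≤ n → m * m ≤ m ^ n
m*m≤m^n m (s≤s (s≤s (z≤n {n}))) = *-monoʳ-≤ m (m≤m^n m {suc n} (s≤s z≤n))

m<m^n : ∀ {m n} → 2 ≤ m → 2 ≤ n → m < m ^ n
m<m^n {m@(suc _)} 2≤m 2≤n = ≤-trans (m<m*n m m 2≤m) (m*m≤m^n m 2≤n)

-- the first two terms of the binomial expansion of (m + d) ^ (1 + q)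
^-binomial-≤ : ∀ m d q → d ^ suc q + m * d ^ q ≤ (m + d) ^ suc q
^-binomial-≤ m d q = begin
  d * d ^ q + m * d ^ q  ≡⟨ *-distribʳ-+ (d ^ q) d m ⟨
  (d + m) * d ^ q        ≤⟨ *-monoʳ-≤ (d + m) (^-monoˡ-≤ q (m≤n+m d m)) ⟩
  (d + m) * (m + d) ^ q  ≡⟨ cong (_* (m + d) ^ q) (+-comm d m) ⟩
  (m + d) ^ suc q        ∎
  where open ≤-Reasoning

^-+-≥ : ∀ {p} → 2 ≤ p → ∀ m d → d ^ p + m * d ≤ (m + d) ^ p
^-+-≥ (s≤s (s≤s (z≤n {q}))) m d =
  ≤-trans (+-monoʳ-≤ (d ^ suc (suc q)) (*-monoʳ-≤ m (m≤m^n d {suc q} (s≤s z≤n)))) (^-binomial-≤ m d (suc q))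

*-≤-^-+ : ∀ {p} → 2 ≤ p → ∀ {K} m → K ≤ m → suc m * K ≤ m ^ p + m
*-≤-^-+ {p} 2≤p {K} m K≤m = begin
  K + m * K    ≤⟨ +-mono-≤ K≤m (*-monoʳ-≤ m K≤m) ⟩
  m + m * m    ≤⟨ +-monoʳ-≤ m (m*m≤m^n m 2≤p) ⟩
  m + m ^ p    ≡⟨ +-comm m (m ^ p) ⟩
  m ^ p + m    ∎
  where open ≤-Reasoning

-- Exhaustive search and maxima

record Searchable (A : Set) : Set₁ where
  field
    _≈_    : A → A → Set
    ≈-refl : ∀ {a} → a ≈ a
    search : (P : A → Set) → (∀ {a b} → a ≈ b → P a → P b) → (∀ a → Dec (P a)) → Dec (Σ A P)
open Searchable

Fin-searchable : ∀ n → Searchable (Fin n)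
Fin-searchable n = record { _≈_ = _≡_ ; ≈-refl = refl ; search = λ P _ P? → any? P? }

Bool-searchable : Searchable Bool
Bool-searchable = record { _≈_ = _≡_ ; ≈-refl = refl ; search = search-Bool }
  where
  search-Bool : (P : Bool → Set) → (∀ {a b} → a ≡ b → P a → P b) → (∀ a → Dec (P a)) → Dec (Σ Bool P)
  search-Bool P _ P? with P? true | P? false
  ... | yes pt | _      = yes (true , pt)
  ... | no _   | yes pf = yes (false , pf)
  ... | no ¬pt | no ¬pf = no λ { (true , pt) → ¬pt pt ; (false , pf) → ¬pf pf }

-- Without function extensionality, predicates on functions must respect pointwise equality.
→-searchable : ∀ {A : Set} k → Searchable A → Searchable (Fin k → A)
→-searchable {A} k S = record
  { _≈_ = λ f g → ∀ i → _≈_ S (f i) (g i) ; ≈-refl = λ i → ≈-refl S ; search = search-→ k }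
  where
  search-→ : ∀ k (P : (Fin k → A) → Set) → (∀ {f g} → (∀ i → _≈_ S (f i) (g i)) → P f → P g) →
             (∀ f → Dec (P f)) → Dec (Σ (Fin k → A) P)
  search-→ zero P resp P? with P? (λ ())
  ... | yes p = yes (_ , p)
  ... | no ¬p = no λ (f , pf) → ¬p (resp (λ ()) pf)
  search-→ (suc k) P resp P?
    with search S (λ a → Σ (Fin k → A) λ g → P (a ∷ g))
           (λ a≈b (g , p) → g , resp (λ { zero → a≈b ; (suc i) → ≈-refl S }) p)
           (λ a → search-→ k (λ g → P (a ∷ g))
                    (λ g≈h → resp (λ { zero → ≈-refl S ; (suc i) → g≈h i }))
                    (λ g → P? (a ∷ g)))
  ... | yes (a , g , p) = yes (a ∷ g , p)
  ... | no ¬p = no λ (f , pf) →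
          ¬p (f zero , f ∘ suc , resp (λ { zero → ≈-refl S ; (suc i) → ≈-refl S }) pf)

greatest : (P : ℕ → Set) → (∀ t → Dec (P t)) → ∀ B → (∃ λ x → x ≤ B × P x) →
           ∃ λ t → P t × (∀ x → x ≤ B → P x → x ≤ t)
greatest P P? B w with P? B
... | yes pB = B , pB , λ _ x≤B _ → x≤B
greatest P P? zero    (x , x≤0 , px)   | no ¬pB = ⊥-elim (¬pB (subst P (n≤0⇒n≡0 x≤0) px))
greatest P P? (suc B) (x , x≤1+B , px) | no ¬pB =
  let t , pt , max = greatest P P? B (x , below x≤1+B px , px)
  in  t , pt , λ y y≤1+B py → max y (below y≤1+B py) py
  where
  below : ∀ {y} → y ≤ suc B → P y → y ≤ B
  below y≤1+B py = ≤-pred (≤∧≢⇒< y≤1+B λ { refl → ¬pB py })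

-- Graphs, degrees and e_p

does-true : ∀ {A : Set} (a? : Dec A) → does a? ≡ true → A
does-true (yes a) _ = a

Edge : ∀ {n} → Graph n → Fin n → Fin n → Set
Edge G i j = adj G i j ≡ true

edge-sym : ∀ {n} (G : Graph n) {i j} → Edge G i j → Edge G j i
edge-sym G {i} {j} e = trans (Graph.sym G j i) e

edge-irrefl : ∀ {n} (G : Graph n) {i} → ¬ Edge G i i
edge-irrefl G {i} e with trans (sym (irrefl G i)) e
... | ()

edge⇒≢ : ∀ {n} (G : Graph n) {i j} → Edge G i j → i ≢ j
edge⇒≢ G e refl = edge-irrefl G e

_∈Im_ : ∀ {k n} → Fin n → (Fin k → Fin n) → Set
z ∈Im f = ∃ λ i → f i ≡ z

IsCopy : ∀ {k n} → Graph n → Graph k → (Fin k → Fin n) → Set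
IsCopy G H f = Injective _≡_ _≡_ f × (∀ i j → Edge H i j → Edge G (f i) (f j))

isCopy-resp : ∀ {k n} (G : Graph n) (H : Graph k) {f g : Fin k → Fin n} →
              (∀ i → f i ≡ g i) → IsCopy G H f → IsCopy G H g
isCopy-resp G H {f} {g} f≗g (f-inj , f-edges) =
  (λ {x} {y} gx≡gy → f-inj (trans (f≗g x) (trans gx≡gy (sym (f≗g y))))) ,
  (λ i j e → subst₂ (Edge G) (f≗g i) (f≗g j) (f-edges i j e))

isCopy? : ∀ {k n} (G : Graph n) (H : Graph k) f → Dec (IsCopy G H f)
isCopy? G H f = injective? ×-dec edges?
  where
  injective? = map′ (λ h {x} {y} → h x y) (λ h x y → h {x} {y})
                    (all? λ x → all? λ y → (f x ≟ f y) →-dec (x ≟ y))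
  edges? = all? λ i → all? λ j → (adj H i j Bool.≟ true) →-dec (adj G (f i) (f j) Bool.≟ true)

search-copy : ∀ {k n} (G : Graph n) (H : Graph k) (R : (Fin k → Fin n) → Set) →
              (∀ {f g} → (∀ i → f i ≡ g i) → R f → R g) → (∀ f → Dec (R f)) →
              Dec (Σ (Fin k → Fin n) λ f → IsCopy G H f × R f)
search-copy {k} {n} G H R R-resp R? =
  search (→-searchable k (Fin-searchable n)) _
    (λ f≗g (copy , r) → isCopy-resp G H f≗g copy , R-resp f≗g r)
    (λ f → isCopy? G H f ×-dec R? f)

contains? : ∀ {k n} (G : Graph n) (H : Graph k) → Dec (Contains G H)
contains? {k} {n} G H = search (→-searchable k (Fin-searchable n)) _ (isCopy-resp G H) (isCopy? G H)

_≈G_ : ∀ {n} → Graph n → Graph n → Set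
G ≈G G′ = ∀ i j → adj G i j ≡ adj G′ i j

search-graph : ∀ {n} (Q : Graph n → Set) → (∀ {G G′} → G ≈G G′ → Q G → Q G′) → (∀ G → Dec (Q G)) →
               Dec (Σ (Graph n) Q)
search-graph {n} Q Q-resp Q? with search (→-searchable n (→-searchable n Bool-searchable)) P P-resp P?
  where
  P : (Fin n → Fin n → Bool) → Set
  P a = Σ (∀ i j → a i j ≡ a j i) λ a-sym → Σ (∀ i → a i i ≡ false) λ a-irr →
        Q (record { adj = a ; sym = a-sym ; irrefl = a-irr })
  P-resp : ∀ {a b} → (∀ i j → a i j ≡ b i j) → P a → P b
  P-resp a≗b (a-sym , a-irr , q) =
    (λ i j → trans (sym (a≗b i j)) (trans (a-sym i j) (a≗b j i))) ,
    (λ i → trans (sym (a≗b i i)) (a-irr i)) , Q-resp a≗b q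
  P? : ∀ a → Dec (P a)
  P? a with all? (λ i → all? λ j → a i j Bool.≟ a j i) | all? (λ i → a i i Bool.≟ false)
  ... | no ¬sym  | _        = no λ (a-sym , _) → ¬sym a-sym
  ... | yes _    | no ¬irr  = no λ (_ , a-irr , _) → ¬irr a-irr
  ... | yes a-sym | yes a-irr with Q? (record { adj = a ; sym = a-sym ; irrefl = a-irr })
  ...   | yes q = yes (a-sym , a-irr , q)
  ...   | no ¬q = no λ (_ , _ , q) → ¬q (Q-resp (λ _ _ → refl) q)
... | yes (_ , _ , _ , q) = yes (_ , q)
... | no ¬p = no λ (G , q) → ¬p (adj G , Graph.sym G , irrefl G , q)

degree-∑ : ∀ {n} (G : Graph n) y → degree G y ≡ ∑[ j < n ] b2n (adj G y j)
degree-∑ {n} G y = ∑-allFin n _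

e-∑ : ∀ p {n} (G : Graph n) → e p G ≡ ∑[ y < n ] (degree G y ^ p)
e-∑ p {n} G = ∑-allFin n _

degree-cong : ∀ {n} {G G′ : Graph n} → G ≈G G′ → ∀ y → degree G y ≡ degree G′ y
degree-cong {G = G} {G′} G≈G′ y =
  trans (degree-∑ G y) (trans (sum-cong-≗ (cong b2n ∘ G≈G′ y)) (sym (degree-∑ G′ y)))

e-cong : ∀ p {n} {G G′ : Graph n} → G ≈G G′ → e p G ≡ e p G′
e-cong p {G = G} {G′} G≈G′ =
  trans (e-∑ p G) (trans (sum-cong-≗ (cong (_^ p) ∘ degree-cong {G = G} {G′} G≈G′)) (sym (e-∑ p G′)))

contains-cong : ∀ {k n} {G G′ : Graph n} (H : Graph k) → G ≈G G′ → Contains G H → Contains G′ H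
contains-cong H G≈G′ (f , f-inj , f-edges) = f , f-inj , λ i j e → trans (sym (G≈G′ _ _)) (f-edges i j e)

degree-≤-cover : ∀ {k n} (G : Graph n) (f : Fin k → Fin n) y →
                 (∀ z → Edge G y z → z ∈Im f) → degree G y ≤ k
degree-≤-cover {k} {n} G f y cover = begin
  degree G y                                  ≡⟨ degree-∑ G y ⟩
  ∑[ j < n ] b2n (adj G y j)                  ≤⟨ ∑-mono-≤ counted ⟩
  ∑[ j < n ] ∑[ i < k ] indicator (f i) j     ≡⟨ ∑-comm (λ j i → indicator (f i) j) ⟩
  ∑[ i < k ] ∑[ j < n ] indicator (f i) j     ≡⟨ sum-cong-≗ (∑-indicator ∘ f) ⟩
  ∑[ i < k ] 1                                ≡⟨ ∑-const k 1 ⟩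
  k * 1                                       ≡⟨ *-identityʳ k ⟩
  k                                           ∎
  where
  open ≤-Reasoning
  counted : ∀ j → b2n (adj G y j) ≤ ∑[ i < k ] indicator (f i) j
  counted j with adj G y j in e
  ... | false = z≤n
  ... | true with cover j e
  ...   | i , refl = ≤-trans (≤-reflexive (sym (indicator-self (f i)))) (≤-∑ (λ i′ → indicator (f i′) (f i)) i)

degree≤1 : ∀ {n} (G : Graph n) y → (∀ a b → Edge G y a → Edge G y b → a ≡ b) → degree G y ≤ 1
degree≤1 G y unique with any? (λ a → adj G y a Bool.≟ true)
... | yes (a , ya) = degree-≤-cover G (λ (_ : Fin 1) → a) y λ z yz → zero , unique a z ya yz
... | no ¬nb       = degree-≤-cover G (λ (_ : Fin 1) → y) y λ z yz → ⊥-elim (¬nb (z , yz))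

degree≤n : ∀ {n} (G : Graph n) y → degree G y ≤ n
degree≤n {n} G y = degree-≤-cover G id y λ z _ → z , refl

e≤n*n^p : ∀ p {n} (G : Graph n) → e p G ≤ n * n ^ p
e≤n*n^p p {n} G = subst (_≤ n * n ^ p) (sym (e-∑ p G)) (∑-≤-const (n ^ p) (λ y → ^-monoˡ-≤ p (degree≤n G y)))

contains-addPendant⇒contains : ∀ {k n} (H : Graph k) v (G : Graph n) → Contains G (addPendant H v) → Contains G H
contains-addPendant⇒contains H v G (f , f-inj , f-edges) = f ∘ suc , suc-injective ∘ f-inj , λ i j → f-edges (suc i) (suc j)

IsTp-exists : ∀ p {n k} (H : Graph k) (G₀ : Graph n) → ¬ Contains G₀ H → ∃ (IsTp p n H)
IsTp-exists p {n} H G₀ G₀-free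
  with greatest Attained Attained? (n * n ^ p) (e p G₀ , e≤n*n^p p G₀ , G₀ , G₀-free , refl)
  where
  Attained : ℕ → Set
  Attained t = Σ (Graph n) λ G → ¬ Contains G H × e p G ≡ t
  Attained? : ∀ t → Dec (Attained t)
  Attained? t = search-graph _
    (λ {G} {G′} G≈G′ (G-free , e≡t) →
       G-free ∘ contains-cong {G = G′} {G} H (λ i j → sym (G≈G′ i j)) ,
       trans (sym (e-cong p {G = G} {G′} G≈G′)) e≡t)
    (λ G → ¬? (contains? G H) ×-dec (e p G ≟ℕ t))
... | t , attained , max = t , attained , λ G G-free → max (e p G) (e≤n*n^p p G) (G , G-free , refl)

IsTp-dominated : ∀ p {n k k′} (H : Graph k) (H′ : Graph k′) {t} →
  (∀ (G : Graph n) → Contains G H′ → Contains G H) →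
  (∀ (G : Graph n) → ¬ Contains G H′ → Σ (Graph n) λ G′ → ¬ Contains G′ H × e p G ≤ e p G′) →
  IsTp p n H t → IsTp p n H′ t
IsTp-dominated p H H′ H′⇒H dominated ((G₀ , G₀-free , e≡t) , max) =
  (G₀ , G₀-free ∘ H′⇒H G₀ , e≡t) ,
  λ G G-free → let G′ , G′-free , e≤e′ = dominated G G-free in ≤-trans e≤e′ (max G′ G′-free)

upper-edge : ∀ {k} → Graph k → Fin k → Fin k → ℕ
upper-edge H i j = if does (toℕ i <? toℕ j) then b2n (adj H i j) else 0

edgeCount-∑ : ∀ {k} (H : Graph k) → edgeCount H ≡ ∑[ i < k ] ∑[ j < k ] upper-edge H i j
edgeCount-∑ {k} H = trans (∑-allFin k _) (sum-cong-≗ λ i → ∑-allFin k (upper-edge H i))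

edgeCount≤1-ordered : ∀ {k} (H : Graph k) a b →
  (∀ i j → Edge H i j → toℕ i < toℕ j → i ≡ a × j ≡ b) → edgeCount H ≤ 1
edgeCount≤1-ordered {k} H a b only = subst (_≤ 1) (sym (edgeCount-∑ H))
  (∑-≤-indicator-* a 1 λ i → ≤-trans (∑-≤-indicator-* b (indicator a i) (bound i)) (≤-reflexive (sym (*-identityʳ _))))
  where
  bound : ∀ i j → upper-edge H i j ≤ indicator b j * indicator a i
  bound i j with toℕ i <ᵇ toℕ j in lt
  ... | false = z≤n
  ... | true with adj H i j in e
  ...   | false = z≤n
  ...   | true with only i j e (<ᵇ⇒< _ _ (subst T (sym lt) tt))
  ...     | refl , refl = ≤-reflexive (sym (cong₂ _*_ (indicator-self b) (indicator-self a)))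

edgeCount≤1 : ∀ {k} (H : Graph k) a b →
  (∀ i j → Edge H i j → (i ≡ a × j ≡ b) ⊎ (i ≡ b × j ≡ a)) → edgeCount H ≤ 1
edgeCount≤1 H a b only with toℕ a <? toℕ b
... | yes a<b = edgeCount≤1-ordered H a b λ i j e i<j → oriented i j (only i j e) i<j
  where
  oriented : ∀ i j → (i ≡ a × j ≡ b) ⊎ (i ≡ b × j ≡ a) → toℕ i < toℕ j → i ≡ a × j ≡ b
  oriented i j (inj₁ ab)          _   = ab
  oriented i j (inj₂ (refl , refl)) b<a = ⊥-elim (<-asym b<a a<b)
... | no a≮b = edgeCount≤1-ordered H b a λ i j e i<j → oriented i j (only i j e) i<j
  where
  oriented : ∀ i j → (i ≡ a × j ≡ b) ⊎ (i ≡ b × j ≡ a) → toℕ i < toℕ j → i ≡ b × j ≡ a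
  oriented i j (inj₁ (refl , refl)) a<b = ⊥-elim (a≮b a<b)
  oriented i j (inj₂ ba)          _   = ba

edge-exists : ∀ {k} (H : Graph k) → 1 ≤ edgeCount H → ∃ λ a → ∃ λ b → Edge H a b
edge-exists {k} H 1≤edges with any? (λ a → any? λ b → adj H a b Bool.≟ true)
... | yes edge = edge
... | no ¬edge = ⊥-elim (<⇒≱ 1≤edges (subst (_≤ 0) (sym (edgeCount-∑ H))
                   (≤-trans (∑-≤-const 0 λ i → ≤-trans (∑-≤-const 0 (none i)) (≤-reflexive (*-zeroʳ k)))
                            (≤-reflexive (*-zeroʳ k)))))
  where
  none : ∀ i j → upper-edge H i j ≤ 0
  none i j with toℕ i <ᵇ toℕ j
  ... | false = z≤n
  ... | true with adj H i j in e
  ...   | false = z≤n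
  ...   | true = ⊥-elim (¬edge (i , j , e))

star-adj : ∀ {m} → Fin (suc m) → Fin (suc m) → Bool
star-adj zero    zero    = false
star-adj zero    (suc _) = true
star-adj (suc _) zero    = true
star-adj (suc _) (suc _) = false

star : ∀ m → Graph (suc m)
star m = record { adj = star-adj ; sym = star-sym ; irrefl = star-irrefl }
  where
  star-sym : ∀ i j → star-adj {m} i j ≡ star-adj j i
  star-sym zero    zero    = refl
  star-sym zero    (suc _) = refl
  star-sym (suc _) zero    = refl
  star-sym (suc _) (suc _) = refl
  star-irrefl : ∀ i → star-adj {m} i i ≡ false
  star-irrefl zero    = refl
  star-irrefl (suc _) = refl

star-edge : ∀ {m} {a b : Fin (suc m)} → Edge (star m) a b → a ≡ zero ⊎ b ≡ zero
star-edge {a = zero}              _ = inj₁ refl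
star-edge {a = suc _} {b = zero}  _ = inj₂ refl

e-star : ∀ p m → e p (star m) ≡ m ^ p + m
e-star p m = begin
  e p (star m)                                      ≡⟨ e-∑ p (star m) ⟩
  degree (star m) zero ^ p + ∑[ i < m ] (degree (star m) (suc i) ^ p)
    ≡⟨ cong₂ _+_ (cong (_^ p) centre) (sum-cong-≗ λ i → cong (_^ p) (leaf i)) ⟩
  m ^ p + ∑[ i < m ] (1 ^ p)                        ≡⟨ cong (m ^ p +_) (sum-cong-≗ {m} (λ _ → ^-zeroˡ p)) ⟩
  m ^ p + ∑[ i < m ] 1                              ≡⟨ cong (m ^ p +_) (trans (∑-const m 1) (*-identityʳ m)) ⟩
  m ^ p + m                                         ∎
  where
  open ≡-Reasoning
  centre : degree (star m) zero ≡ m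
  centre = trans (degree-∑ (star m) zero) (trans (∑-const m 1) (*-identityʳ m))
  leaf : ∀ i → degree (star m) (suc i) ≡ 1
  leaf i = trans (degree-∑ (star m) (suc i)) (cong suc (sum-replicate-zero m))

star-copy-through : ∀ {k m} (H : Graph k) {f : Fin k → Fin (suc m)} → IsCopy (star m) H f →
                    ∀ {c} → f c ≡ zero → ∀ i j → Edge H i j → i ≡ c ⊎ j ≡ c
star-copy-through H (f-inj , f-edges) fc≡0 i j e with star-edge (f-edges i j e)
... | inj₁ fi≡0 = inj₁ (f-inj (trans fi≡0 (sym fc≡0)))
... | inj₂ fj≡0 = inj₂ (f-inj (trans fj≡0 (sym fc≡0)))

e≤e-star : ∀ {p} → 2 ≤ p → ∀ {K m} → K ^ p ≤ m → (G : Graph (suc m)) → (∀ y → degree G y ≤ K) →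
           e p G ≤ e p (star m)
e≤e-star {p} 2≤p {K} {m} K^p≤m G bounded = begin
  e p G                            ≡⟨ e-∑ p G ⟩
  ∑[ y < suc m ] (degree G y ^ p)  ≤⟨ ∑-≤-const (K ^ p) (λ y → ^-monoˡ-≤ p (bounded y)) ⟩
  suc m * K ^ p                    ≤⟨ *-≤-^-+ 2≤p m K^p≤m ⟩
  m ^ p + m                        ≡⟨ e-star p m ⟨
  e p (star m)                     ∎
  where open ≤-Reasoning

-- Copies of H in H′-free graphs

TwoNeighbours : ∀ {k} → Graph k → Fin k → Set
TwoNeighbours {k} H u = Σ (Fin k) λ a → Σ (Fin k) λ b → a ≢ b × Edge H u a × Edge H u b

twoNeighbours? : ∀ {k} (H : Graph k) → Dec (∃ (TwoNeighbours H))
twoNeighbours? H = any? λ u → any? λ a → any? λ b →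
  ¬? (a ≟ b) ×-dec (adj H u a Bool.≟ true) ×-dec (adj H u b Bool.≟ true)

Matching : ∀ {k} → Graph k → Set
Matching H = ∀ {u a b} → Edge H u a → Edge H u b → a ≡ b

¬twoNeighbours⇒matching : ∀ {k} (H : Graph k) → ¬ ∃ (TwoNeighbours H) → Matching H
¬twoNeighbours⇒matching H none {u} {a} {b} ua ub with a ≟ b
... | yes a≡b = a≡b
... | no a≢b  = ⊥-elim (none (u , a , b , a≢b , ua , ub))

twoNeighbours⇒2≤k : ∀ {k} {H : Graph k} {u} → TwoNeighbours H u → 2 ≤ k
twoNeighbours⇒2≤k {suc zero}    (zero , zero , a≢b , _) = ⊥-elim (a≢b refl)
twoNeighbours⇒2≤k {suc (suc k)} _                      = s≤s (s≤s z≤n)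

-- In a matching, an edge e₁e₂ of a copy can be moved onto any edge ya outside it.
module EdgeReplacement {k n} {H : Graph k} {G : Graph n}
  (matching : Matching H) {e₁ e₂} (e₁e₂ : Edge H e₁ e₂)
  {f} (copy : IsCopy G H f) {y a} (y∉f : ¬ y ∈Im f) (a∉f : ¬ a ∈Im f) (ya : Edge G y a) where

  data Slot (i : Fin k) (u : Fin n) : Set where
    at-e₁ : i ≡ e₁ → u ≡ y → Slot i u
    at-e₂ : i ≡ e₂ → u ≡ a → Slot i u
    kept  : i ≢ e₁ → i ≢ e₂ → u ≡ f i → Slot i u

  replaced : Fin k → Fin n
  replaced i with i ≟ e₁ | i ≟ e₂
  ... | yes _ | _     = y
  ... | no _  | yes _ = a
  ... | no _  | no _  = f i

  slot : ∀ i → Slot i (replaced i)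
  slot i with i ≟ e₁ | i ≟ e₂
  ... | yes p | _     = at-e₁ p refl
  ... | no p  | yes q = at-e₂ q refl
  ... | no p  | no q  = kept p q refl

  replaced-e₁ : replaced e₁ ≡ y
  replaced-e₁ with slot e₁
  ... | at-e₁ _ eq   = eq
  ... | at-e₂ p _    = ⊥-elim (edge⇒≢ H e₁e₂ p)
  ... | kept p _ _   = ⊥-elim (p refl)

  ∈Im-replaced : ∀ {z} → z ∈Im replaced → z ≡ y ⊎ z ≡ a ⊎ z ∈Im f
  ∈Im-replaced (i , refl) with slot i
  ... | at-e₁ _ eq   = inj₁ eq
  ... | at-e₂ _ eq   = inj₂ (inj₁ eq)
  ... | kept _ _ eq  = inj₂ (inj₂ (i , sym eq))

  replaced-inj : Injective _≡_ _≡_ replaced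
  replaced-inj {i} {j} eq with slot i | slot j
  ... | at-e₁ p _    | at-e₁ q _    = trans p (sym q)
  ... | at-e₂ p _    | at-e₂ q _    = trans p (sym q)
  ... | at-e₁ _ u≡y  | at-e₂ _ w≡a  = ⊥-elim (edge⇒≢ G ya (trans (sym u≡y) (trans eq w≡a)))
  ... | at-e₂ _ u≡a  | at-e₁ _ w≡y  = ⊥-elim (edge⇒≢ G ya (trans (sym w≡y) (trans (sym eq) u≡a)))
  ... | at-e₁ _ u≡y  | kept _ _ w≡f = ⊥-elim (y∉f (j , trans (sym w≡f) (trans (sym eq) u≡y)))
  ... | at-e₂ _ u≡a  | kept _ _ w≡f = ⊥-elim (a∉f (j , trans (sym w≡f) (trans (sym eq) u≡a)))
  ... | kept _ _ u≡f | at-e₁ _ w≡y  = ⊥-elim (y∉f (i , trans (sym u≡f) (trans eq w≡y)))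
  ... | kept _ _ u≡f | at-e₂ _ w≡a  = ⊥-elim (a∉f (i , trans (sym u≡f) (trans eq w≡a)))
  ... | kept _ _ u≡f | kept _ _ w≡f = proj₁ copy (trans (sym u≡f) (trans eq w≡f))

  replaced-edges : ∀ i j → Edge H i j → Edge G (replaced i) (replaced j)
  replaced-edges i j e with slot i | slot j
  ... | at-e₁ refl u≡y | at-e₂ refl w≡a = subst₂ (Edge G) (sym u≡y) (sym w≡a) ya
  ... | at-e₂ refl u≡a | at-e₁ refl w≡y = subst₂ (Edge G) (sym u≡a) (sym w≡y) (edge-sym G ya)
  ... | kept _ _ u≡f   | kept _ _ w≡f   = subst₂ (Edge G) (sym u≡f) (sym w≡f) (proj₂ copy i j e)
  ... | at-e₁ refl _   | at-e₁ refl _   = ⊥-elim (edge-irrefl H e)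
  ... | at-e₂ refl _   | at-e₂ refl _   = ⊥-elim (edge-irrefl H e)
  ... | at-e₁ refl _   | kept _ j≢e₂ _  = ⊥-elim (j≢e₂ (matching e e₁e₂))
  ... | at-e₂ refl _   | kept j≢e₁ _ _  = ⊥-elim (j≢e₁ (matching e (edge-sym H e₁e₂)))
  ... | kept _ i≢e₂ _  | at-e₁ refl _   = ⊥-elim (i≢e₂ (matching (edge-sym H e) e₁e₂))
  ... | kept i≢e₁ _ _  | at-e₂ refl _   = ⊥-elim (i≢e₁ (matching (edge-sym H e) (edge-sym H e₁e₂)))

  replaced-copy : IsCopy G H replaced
  replaced-copy = replaced-inj , replaced-edges

module _ {k} (H : Graph k) (vt : VertexTransitive H) where

  twoNeighbours-everywhere : ∃ (TwoNeighbours H) → ∀ w → TwoNeighbours H w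
  twoNeighbours-everywhere (u , a , b , a≢b , ua , ub) w with vt u w
  ... | σ , ((σ-inj , _) , σ-aut) , refl =
    σ a , σ b , a≢b ∘ σ-inj , trans (σ-aut u a) ua , trans (σ-aut u b) ub

  -- An automorphism moving v to i hangs the pendant of H′ = addPendant H v on the outside neighbour z.
  copy-closed : ∀ v {n} (G : Graph n) → ¬ Contains G (addPendant H v) →
                ∀ {f} → IsCopy G H f → ∀ i {z} → Edge G (f i) z → z ∈Im f
  copy-closed v {n} G free {f} (f-inj , f-edges) i {z} fi-z with any? (λ j → f j ≟ z)
  ... | yes z∈f = z∈f
  ... | no z∉f with vt v i
  ...   | σ , ((σ-inj , _) , σ-aut) , refl = ⊥-elim (free (F , F-inj , F-edges))
    where
    F : Fin (suc k) → Fin n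
    F zero    = z
    F (suc j) = f (σ j)
    F-inj : Injective _≡_ _≡_ F
    F-inj {zero}  {zero}  _  = refl
    F-inj {zero}  {suc j} eq = ⊥-elim (z∉f (σ j , sym eq))
    F-inj {suc j} {zero}  eq = ⊥-elim (z∉f (σ j , eq))
    F-inj {suc a} {suc b} eq = cong suc (σ-inj (f-inj eq))
    F-edges : ∀ a b → Edge (addPendant H v) a b → Edge G (F a) (F b)
    F-edges zero    (suc j) e with refl ← does-true (j ≟ v) e = edge-sym G fi-z
    F-edges (suc j) zero    e with refl ← does-true (j ≟ v) e = fi-z
    F-edges (suc a) (suc b) e = f-edges (σ a) (σ b) (trans (σ-aut a b) e)

  copy-degree : ∀ v {n} (G : Graph n) → ¬ Contains G (addPendant H v) →
                ∀ {f} → IsCopy G H f → ∀ i → degree G (f i) ≤ k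
  copy-degree v G free {f} copy i = degree-≤-cover G f (f i) λ _ → copy-closed v G free copy i

  off-copy-degree≤1 : Matching H → ∀ {e₁ e₂} → Edge H e₁ e₂ →
    ∀ v {n} (G : Graph n) → ¬ Contains G (addPendant H v) →
    ∀ {f} → IsCopy G H f → ∀ {y} → ¬ y ∈Im f → degree G y ≤ 1
  off-copy-degree≤1 matching {e₁} e₁e₂ v G free {f} copy {y} y∉f = degree≤1 G y one-neighbour
    where
    off : ∀ {z} → Edge G y z → ¬ z ∈Im f
    off yz (i , refl) = y∉f (copy-closed v G free copy i (edge-sym G yz))
    one-neighbour : ∀ a b → Edge G y a → Edge G y b → a ≡ b
    one-neighbour a b ya yb with a ≟ b
    ... | yes a≡b = a≡b
    ... | no a≢b = ⊥-elim (b-nowhere (∈Im-replaced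
            (copy-closed v G free replaced-copy e₁ (subst (λ u → Edge G u b) (sym replaced-e₁) yb))))
      where
      open EdgeReplacement {H = H} {G = G} matching e₁e₂ copy y∉f (off ya) ya
      b-nowhere : ¬ (b ≡ y ⊎ b ≡ a ⊎ b ∈Im f)
      b-nowhere (inj₁ refl)        = edge-irrefl G yb
      b-nowhere (inj₂ (inj₁ b≡a))  = a≢b (sym b≡a)
      b-nowhere (inj₂ (inj₂ b∈f))  = off yb b∈f

  copy⇒degree≤k : Matching H → ∀ {e₁ e₂} → Edge H e₁ e₂ →
    ∀ v {n} (G : Graph n) → ¬ Contains G (addPendant H v) → ∀ {f} → IsCopy G H f → ∀ y → degree G y ≤ k
  copy⇒degree≤k matching {e₁} e₁e₂ v G free {f} copy y with any? (λ i → f i ≟ y)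
  ... | yes (i , refl) = copy-degree v G free copy i
  ... | no y∉f = ≤-trans (off-copy-degree≤1 matching e₁e₂ v G free copy y∉f) (≤-trans (s≤s z≤n) (toℕ<n e₁))

  module Rewiring {p} (2≤p : 2 ≤ p) (cherry : ∃ (TwoNeighbours H)) (v : Fin k)
                  {n} (G : Graph n) (free : ¬ Contains G (addPendant H v))
                  (x : Fin n) (heavy : k ^ p ≤ degree G x) where

    OnCopy : Fin n → Set
    OnCopy y = Σ (Fin k → Fin n) λ f → IsCopy G H f × y ∈Im f

    onCopy? : ∀ y → Dec (OnCopy y)
    onCopy? y = search-copy G H (y ∈Im_) (λ f≗g (i , fi≡y) → i , trans (sym (f≗g i)) fi≡y)
                            (λ f → any? λ i → f i ≟ y)

    onCopy-degree : ∀ {y} → OnCopy y → degree G y ≤ k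
    onCopy-degree (f , copy , i , refl) = copy-degree v G free copy i

    onCopy-closed : ∀ {y z} → OnCopy y → Edge G y z → OnCopy z
    onCopy-closed (f , copy , i , refl) yz = f , copy , copy-closed v G free copy i yz

    x-offCopy : ¬ OnCopy x
    x-offCopy x-on@(_ , _ , i , _) =
      <⇒≱ (m<m^n (twoNeighbours⇒2≤k {H = H} (twoNeighbours-everywhere cherry i)) 2≤p)
          (≤-trans heavy (onCopy-degree x-on))

    onCopy⇒≢x : ∀ {y} → OnCopy y → y ≢ x
    onCopy⇒≢x y-on refl = x-offCopy y-on

    -- Vertices on copies of H lose all their edges and become leaves hanging on x.
    rewired-adj : ∀ {i j} → Dec (OnCopy i) → Dec (OnCopy j) → Bool
    rewired-adj {i} {j} (yes _) _       = does (j ≟ x)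
    rewired-adj {i} {j} (no _)  (yes _) = does (i ≟ x)
    rewired-adj {i} {j} (no _)  (no _)  = adj G i j

    rewired-sym : ∀ i j (i? : Dec (OnCopy i)) (j? : Dec (OnCopy j)) → rewired-adj i? j? ≡ rewired-adj j? i?
    rewired-sym i j (yes i-on) (yes j-on) = trans (dec-false (j ≟ x) (onCopy⇒≢x j-on)) (sym (dec-false (i ≟ x) (onCopy⇒≢x i-on)))
    rewired-sym i j (yes _)    (no _)     = refl
    rewired-sym i j (no _)     (yes _)    = refl
    rewired-sym i j (no _)     (no _)     = Graph.sym G i j

    rewired-irrefl : ∀ i (i? : Dec (OnCopy i)) → rewired-adj i? i? ≡ false
    rewired-irrefl i (yes i-on) = dec-false (i ≟ x) (onCopy⇒≢x i-on)
    rewired-irrefl i (no _)     = irrefl G i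

    rewired : Graph n
    rewired = record
      { adj    = λ i j → rewired-adj (onCopy? i) (onCopy? j)
      ; sym    = λ i j → rewired-sym i j (onCopy? i) (onCopy? j)
      ; irrefl = λ i → rewired-irrefl i (onCopy? i)
      }

    adj-onCopy : ∀ {u} → OnCopy u → ∀ w → adj rewired u w ≡ does (w ≟ x)
    adj-onCopy {u} u-on w with onCopy? u
    ... | yes _    = refl
    ... | no u-off = ⊥-elim (u-off u-on)

    adj-offCopy : ∀ {u w} → ¬ OnCopy u → ¬ OnCopy w → adj rewired u w ≡ adj G u w
    adj-offCopy {u} {w} u-off w-off with onCopy? u | onCopy? w
    ... | yes u-on | _        = ⊥-elim (u-off u-on)
    ... | no _     | yes w-on = ⊥-elim (w-off w-on)
    ... | no _     | no _     = refl

    adj-other : ∀ {y} → ¬ OnCopy y → y ≢ x → ∀ j → adj rewired y j ≡ adj G y j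
    adj-other {y} y-off y≢x j with onCopy? y | onCopy? j
    ... | yes y-on | _        = ⊥-elim (y-off y-on)
    ... | no _     | no _     = refl
    ... | no _     | yes j-on with adj G y j in yj
    ...   | true  = ⊥-elim (y-off (onCopy-closed j-on (edge-sym G yj)))
    ...   | false = dec-false (y ≟ x) y≢x

    adj-x : ∀ j → b2n (adj rewired x j) ≡ b2n (does (onCopy? j)) + b2n (adj G x j)
    adj-x j with onCopy? x | onCopy? j
    ... | yes x-on | _        = ⊥-elim (x-offCopy x-on)
    ... | no _     | no _     = refl
    ... | no _     | yes j-on with adj G x j in xj
    ...   | true  = ⊥-elim (x-offCopy (onCopy-closed j-on (edge-sym G xj)))
    ...   | false = cong b2n (dec-true (x ≟ x) refl)

    rewired-free : ¬ Contains rewired H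
    rewired-free (g , g-inj , g-edges) with any? (λ i → onCopy? (g i))
    ... | yes (i , gi-on) =
      let a , b , a≢b , ia , ib = twoNeighbours-everywhere cherry i in a≢b (g-inj (trans (to-x ia) (sym (to-x ib))))
      where
      to-x : ∀ {c} → Edge H i c → g c ≡ x
      to-x {c} ic = does-true (g c ≟ x) (trans (sym (adj-onCopy gi-on (g c))) (g-edges i c ic))
    ... | no off =
      let u₀ , _ = cherry in off (u₀ , g , (g-inj , g-edges-in-G) , u₀ , refl)
      where
      g-edges-in-G : ∀ i j → Edge H i j → Edge G (g i) (g j)
      g-edges-in-G i j e = trans (sym (adj-offCopy (off ∘ (i ,_)) (off ∘ (j ,_)))) (g-edges i j e)

    copyCount : ℕ
    copyCount = ∑[ j < n ] b2n (does (onCopy? j))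

    degree-onCopy : ∀ {y} → OnCopy y → degree rewired y ≡ 1
    degree-onCopy {y} y-on =
      trans (degree-∑ rewired y) (trans (sum-cong-≗ (cong b2n ∘ adj-onCopy y-on)) (∑-indicator x))

    degree-other : ∀ {y} → ¬ OnCopy y → y ≢ x → degree rewired y ≡ degree G y
    degree-other {y} y-off y≢x =
      trans (degree-∑ rewired y) (trans (sum-cong-≗ (cong b2n ∘ adj-other y-off y≢x)) (sym (degree-∑ G y)))

    degree-x : degree rewired x ≡ copyCount + degree G x
    degree-x = begin
      degree rewired x                                              ≡⟨ degree-∑ rewired x ⟩
      ∑[ j < n ] b2n (adj rewired x j)                              ≡⟨ sum-cong-≗ adj-x ⟩
      ∑[ j < n ] (b2n (does (onCopy? j)) + b2n (adj G x j))         ≡⟨ ∑-distrib-+ (b2n ∘ does ∘ onCopy?) (b2n ∘ adj G x) ⟩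
      copyCount + ∑[ j < n ] b2n (adj G x j)                        ≡⟨ cong (copyCount +_) (degree-∑ G x) ⟨
      copyCount + degree G x                                        ∎
      where open ≡-Reasoning

    D : ℕ
    D = degree G x

    pointwise-off-x : ∀ {y} → y ≢ x → (y? : Dec (OnCopy y)) →
                      degree G y ^ p ≤ degree rewired y ^ p + b2n (does y?) * D
    pointwise-off-x {y} y≢x (yes y-on) = begin
      degree G y ^ p                 ≤⟨ ^-monoˡ-≤ p (onCopy-degree y-on) ⟩
      k ^ p                          ≤⟨ heavy ⟩
      D                              ≤⟨ m≤n+m D _ ⟩
      degree rewired y ^ p + D       ≡⟨ cong (degree rewired y ^ p +_) (+-identityʳ D) ⟨
      degree rewired y ^ p + 1 * D   ∎
      where open ≤-Reasoning
    pointwise-off-x {y} y≢x (no y-off) = begin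
      degree G y ^ p                 ≡⟨ cong (_^ p) (degree-other y-off y≢x) ⟨
      degree rewired y ^ p           ≡⟨ +-identityʳ _ ⟨
      degree rewired y ^ p + 0 * D   ∎
      where open ≤-Reasoning

    -- x gains copyCount * D, while each of the copyCount vertices on copies loses at most k ^ p ≤ D.
    pointwise : ∀ y → degree G y ^ p + indicator x y * (copyCount * D) ≤
                      degree rewired y ^ p + b2n (does (onCopy? y)) * D
    pointwise y with y ≟ x
    ... | no y≢x = ≤-trans (≤-reflexive (+-identityʳ _)) (pointwise-off-x y≢x (onCopy? y))
    ... | yes refl = begin
      D ^ p + 1 * (copyCount * D)    ≡⟨ cong (D ^ p +_) (*-identityˡ (copyCount * D)) ⟩
      D ^ p + copyCount * D          ≤⟨ ^-+-≥ 2≤p copyCount D ⟩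
      (copyCount + D) ^ p            ≡⟨ cong (_^ p) degree-x ⟨
      degree rewired y ^ p           ≤⟨ m≤m+n _ _ ⟩
      degree rewired y ^ p + b2n (does (onCopy? y)) * D ∎
      where open ≤-Reasoning

    e-rewired : e p G ≤ e p rewired
    e-rewired = +-cancelʳ-≤ (copyCount * D) _ _ (begin
      e p G + copyCount * D
        ≡⟨ cong₂ _+_ (e-∑ p G) (sym (∑-indicator-* x (copyCount * D))) ⟩
      ∑[ y < n ] (degree G y ^ p) + ∑[ y < n ] (indicator x y * (copyCount * D))
        ≡⟨ ∑-distrib-+ (λ y → degree G y ^ p) (λ y → indicator x y * (copyCount * D)) ⟨
      ∑[ y < n ] (degree G y ^ p + indicator x y * (copyCount * D))
        ≤⟨ ∑-mono-≤ pointwise ⟩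
      ∑[ y < n ] (degree rewired y ^ p + b2n (does (onCopy? y)) * D)
        ≡⟨ ∑-distrib-+ (λ y → degree rewired y ^ p) (λ y → b2n (does (onCopy? y)) * D) ⟩
      ∑[ y < n ] (degree rewired y ^ p) + ∑[ y < n ] (b2n (does (onCopy? y)) * D)
        ≡⟨ cong₂ _+_ (e-∑ p rewired) (*-distribʳ-sum D (b2n ∘ does ∘ onCopy?)) ⟨
      e p rewired + copyCount * D ∎)
      where open ≤-Reasoning

  star-free : 2 ≤ edgeCount H → ∀ m → ¬ Contains (star m) H
  star-free 2≤edges m (f , copy) =
    let e₁ , e₂ , e₁e₂ = edge-exists H (≤-trans (s≤s z≤n) 2≤edges)
    in  [ hub-absurd e₁e₂ , hub-absurd (edge-sym H e₁e₂) ]′ (star-edge (proj₂ copy e₁ e₂ e₁e₂))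
    where
    hub-absurd : ∀ {c u} → Edge H c u → f c ≡ zero → ⊥
    hub-absurd {c} {u} cu fc≡0 with twoNeighbours? H
    ... | yes cherry =
      let a , b , a≢b , ua , ub = twoNeighbours-everywhere cherry u in a≢b (trans (to-c ua) (sym (to-c ub)))
      where
      to-c : ∀ {a} → Edge H u a → a ≡ c
      to-c {a} ua with star-copy-through H copy fc≡0 u a ua
      ... | inj₁ u≡c = ⊥-elim (edge⇒≢ H cu (sym u≡c))
      ... | inj₂ a≡c = a≡c
    ... | no none = <⇒≱ 2≤edges (edgeCount≤1 H c u only-cu)
      where
      only-cu : ∀ i j → Edge H i j → (i ≡ c × j ≡ u) ⊎ (i ≡ u × j ≡ c)
      only-cu i j e with star-copy-through H copy fc≡0 i j e
      ... | inj₁ refl = inj₁ (refl , ¬twoNeighbours⇒matching H none e cu)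
      ... | inj₂ refl = inj₂ (¬twoNeighbours⇒matching H none (edge-sym H e) cu , refl)

  dominated-by-H-free : ∀ {p} → 2 ≤ p → 2 ≤ edgeCount H → ∀ {m} → (k ^ p) ^ p ≤ m →
    ∀ v (G : Graph (suc m)) → ¬ Contains G (addPendant H v) →
    Σ (Graph (suc m)) λ G′ → ¬ Contains G′ H × e p G ≤ e p G′
  dominated-by-H-free {p} 2≤p 2≤edges {m} N≤m v G free with twoNeighbours? H
  ... | yes cherry with any? (λ x → k ^ p ≤? degree G x)
  ...   | yes (x , heavy) = rewired , rewired-free , e-rewired
    where open Rewiring 2≤p cherry v G free x heavy
  ...   | no light = star m , star-free 2≤edges m , e≤e-star 2≤p N≤m G λ y → <⇒≤ (≰⇒> (light ∘ (y ,_)))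
  dominated-by-H-free {p} 2≤p 2≤edges {m} N≤m v G free | no none with contains? G H
  ...   | no H-free = G , H-free , ≤-refl
  ...   | yes (f , copy) =
    let _ , _ , e₁e₂ = edge-exists H (≤-trans (s≤s z≤n) 2≤edges)
    in  star m , star-free 2≤edges m ,
        e≤e-star 2≤p N≤m G λ y → ≤-trans (copy⇒degree≤k (¬twoNeighbours⇒matching H none) e₁e₂ v G free copy y)
                                           (m≤m^n k {p} (≤-trans (s≤s z≤n) 2≤p))

proposition2p3 : (p : ℕ) → 2 ≤ p → (k : ℕ) → (H : Graph k) →
    VertexTransitive H → 2 ≤ edgeCount H →
    Σ ℕ (λ N → (v : Fin k) → (n : ℕ) → N < n →
      Σ ℕ (λ t → IsTp p n (addPendant H v) t × IsTp p n H t))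
proposition2p3 p 2≤p k H vt 2≤edges = (k ^ p) ^ p , tp-equal
  where
  tp-equal : ∀ v n → (k ^ p) ^ p < n → Σ ℕ λ t → IsTp p n (addPendant H v) t × IsTp p n H t
  tp-equal v (suc m) (s≤s N≤m) =
    let t , tp = IsTp-exists p H (star m) (star-free H vt 2≤edges m)
    in  t ,
        IsTp-dominated p H (addPendant H v) (contains-addPendant⇒contains H v)
                       (dominated-by-H-free H vt 2≤p 2≤edges N≤m v) tp ,
        tp
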